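{- If a complete theory $T$ has an antichain tree, then $T$ has a witness of $\mathrm{SSOP}_1$.
   Context: In ${}^{\omega>}2$: $\unlhd$ initial segment, $^\frown$ concatenation. $T$ has an antichain tree if there are a formula $\varphi(x,y)$ and $\langle a_\eta\rangle_{\eta\in{}^{\omega>}2}$ in the monster model of $T$ such that for all $X\subseteq{}^{\omega>}2$, $\{\varphi(x,a_\eta):\eta\in X\}$ is consistent iff the elements of $X$ are pairwise $\unlhd$-incomparable. A witness of $\mathrm{SSOP}_1$ is a pair $\langle\varphi(x,y),\langle b_\eta\rangle_{\eta\in{}^{\omega>}2}\rangle$ such that for all $X\subseteq{}^{\omega>}2$, $\{\varphi(x,b_\eta):\eta\in X\}$ is consistent iff there are no $\eta,\nu\in{}^{\omega>}2$ with $\eta^\frown\langle1\rangle\in X$ and $\eta^\frown\langle0\rangle^\frown\nu\in X$. -}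

module Defs where

open import Level using (Level; 0ℓ) renaming (suc to lsuc)
open import Data.Nat using (ℕ; zero; suc; _+_)
open import Data.Fin using (Fin)
open import Data.Bool using (Bool; true; false)
open import Data.List using (List; []; _∷_; [_]) renaming (_++_ to _++ᴸ_)
open import Data.List.Relation.Unary.All using (All)
open import Data.Product using (Σ; ∃; _×_; _,_)
open import Data.Sum using (_⊎_)
open import Data.Empty using (⊥)
open import Data.Unit using (⊤)
open import Relation.Nullary using (¬_)
open import Relation.Binary.PropositionalEquality using (_≡_; _≢_)
open import Data.Vec.Functional using (Vector) renaming (_∷_ to _∷ᵛ_; _++_ to _++ᵛ_)

-- First-order logic (classical Tarski semantics; classicality is
-- supplied by an excluded-middle hypothesis in the statement).

record Language : Set₁ where
  field
    Func : ℕ → Set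
    Rel  : ℕ → Set
open Language public

data Term (L : Language) (k : ℕ) : Set where
  var : Fin k → Term L k
  app : ∀ {n} → Func L n → (Fin n → Term L k) → Term L k

-- Formulas with free variables among Fin k; quantifiers bind variable 0.
data Formula (L : Language) : ℕ → Set where
  ⊥'   : ∀ {k} → Formula L k
  ⊤'   : ∀ {k} → Formula L k
  _≐_  : ∀ {k} → Term L k → Term L k → Formula L k
  rel  : ∀ {k n} → Rel L n → (Fin n → Term L k) → Formula L k
  ¬'_  : ∀ {k} → Formula L k → Formula L k
  _∧'_ : ∀ {k} → Formula L k → Formula L k → Formula L k
  _∨'_ : ∀ {k} → Formula L k → Formula L k → Formula L k
  _⇒'_ : ∀ {k} → Formula L k → Formula L k → Formula L k
  ∀'_  : ∀ {k} → Formula L (suc k) → Formula L k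
  ∃'_  : ∀ {k} → Formula L (suc k) → Formula L k

Sentence : Language → Set
Sentence L = Formula L 0

record Structure (L : Language) : Set₁ where
  field
    Carrier : Set
    funI    : ∀ {n} → Func L n → (Fin n → Carrier) → Carrier
    relI    : ∀ {n} → Rel L n → (Fin n → Carrier) → Set
open Structure public

module _ {L : Language} (M : Structure L) where
  evalTerm : ∀ {k} → (Fin k → Carrier M) → Term L k → Carrier M
  evalTerm ρ (var i)    = ρ i
  evalTerm ρ (app f ts) = funI M f (λ i → evalTerm ρ (ts i))

  Sat : ∀ {k} → (Fin k → Carrier M) → Formula L k → Set
  Sat ρ ⊥'        = ⊥
  Sat ρ ⊤'        = ⊤
  Sat ρ (s ≐ t)   = evalTerm ρ s ≡ evalTerm ρ t
  Sat ρ (rel R ts) = relI M R (λ i → evalTerm ρ (ts i))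
  Sat ρ (¬' φ)    = ¬ Sat ρ φ
  Sat ρ (φ ∧' ψ)  = Sat ρ φ × Sat ρ ψ
  Sat ρ (φ ∨' ψ)  = Sat ρ φ ⊎ Sat ρ ψ
  Sat ρ (φ ⇒' ψ)  = Sat ρ φ → Sat ρ ψ
  Sat ρ (∀' φ)    = (a : Carrier M) → Sat (a ∷ᵛ ρ) φ
  Sat ρ (∃' φ)    = Σ (Carrier M) λ a → Sat (a ∷ᵛ ρ) φ

_⊨_ : ∀ {L} → Structure L → Sentence L → Set
M ⊨ σ = Sat M (λ ()) σ

Theory : Language → Set₁
Theory L = Sentence L → Set

_⊨ᵀ_ : ∀ {L} → Structure L → Theory L → Set
M ⊨ᵀ T = ∀ σ → T σ → M ⊨ σ

_⊩_ : ∀ {L} → Theory L → Sentence L → Set₁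
T ⊩ σ = (M : Structure _) → M ⊨ᵀ T → M ⊨ σ

Complete : ∀ {L} → Theory L → Set₁
Complete {L} T =
  (Σ (Structure L) λ M → M ⊨ᵀ T) × ((σ : Sentence L) → (T ⊩ σ) ⊎ (T ⊩ (¬' σ)))

-- The binary tree ω>2 = List Bool  (false = 0, true = 1).

Node : Set
Node = List Bool

_⊴_ : Node → Node → Set
η ⊴ ν = ∃ λ ρ → η ++ᴸ ρ ≡ ν

NodeSet : Set₁
NodeSet = Node → Set

Antichain : NodeSet → Set
Antichain X = ∀ η ν → X η → X ν → η ≢ ν → ¬ (η ⊴ ν) × ¬ (ν ⊴ η)

SSOP1-ok : NodeSet → Set
SSOP1-ok X = ¬ (Σ Node λ η → Σ Node λ ν → X (η ++ᴸ [ true ]) × X (η ++ᴸ (false ∷ ν)))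

-- Consistency of {φ(x, a_η) : η ∈ X}, for φ(x,y) with |x| = n, |y| = m,
-- parameters a_η in a model M of T.  By compactness this set is
-- consistent (with the elementary diagram of M, i.e. realised in some
-- elementary extension / the monster model) iff it is finitely
-- satisfiable in M.

PartialConsistent : ∀ {L n m} (M : Structure L) → Formula L (n + m) →
                    (Node → Vector (Carrier M) m) → NodeSet → Set
PartialConsistent {n = n} M φ a X =
  (F : List Node) → All X F →
  Σ (Vector (Carrier M) n) λ c → All (λ η → Sat M (c ++ᵛ a η) φ) F

-- T has an antichain tree: some model M of T (equivalently, the monster
-- model, into which every model of T elementarily embeds) contains an
-- antichain tree.
HasAntichainTree : ∀ {L} → Theory L → Set₁
HasAntichainTree {L} T =
  Σ (Structure L) λ M → M ⊨ᵀ T ×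
  Σ ℕ λ n → Σ ℕ λ m → Σ (Formula L (n + m)) λ φ →
  Σ (Node → Vector (Carrier M) m) λ a →
  ((X : NodeSet) → (PartialConsistent M φ a X → Antichain X) ×
                   (Antichain X → PartialConsistent M φ a X))

HasSSOP1Witness : ∀ {L} → Theory L → Set₁
HasSSOP1Witness {L} T =
  Σ (Structure L) λ M → M ⊨ᵀ T ×
  Σ ℕ λ n → Σ ℕ λ m → Σ (Formula L (n + m)) λ φ →
  Σ (Node → Vector (Carrier M) m) λ b →
  ((X : NodeSet) → (PartialConsistent M φ b X → SSOP1-ok X) ×
                   (SSOP1-ok X → PartialConsistent M φ b X))

{-# OPTIONS --safe #-}
-- Put b_η := a_{encode η} for an embedding encode of the tree into itself such
-- that encode μ ⊴ encode μ' holds exactly when μ = μ' or μ = η⁀⟨1⟩ and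
-- μ' = η⁀⟨0⟩⁀ν.  Then {φ(x, b_η) : η ∈ X} is {φ(x, a_ξ) : ξ ∈ encode[X]}, and
-- encode[X] is an antichain iff X contains no such pair η⁀⟨1⟩, η⁀⟨0⟩⁀ν.
module Submission where

open import Defs
open import Level using (Level)
open import Axiom.ExcludedMiddle using (ExcludedMiddle)
open import Function using (_∘_)
open import Data.Nat using (ℕ; _+_)
open import Data.Bool using (true; false)
open import Data.List using (List; []; _∷_; [_]; _++_; map)
open import Data.List.Properties using (∷-injectiveʳ; ++-conicalˡ; ++-identityʳ-unique)
open import Data.List.Relation.Unary.All as All using (All; []; _∷_)
open import Data.List.Relation.Unary.All.Properties using (map⁺; map⁻)
open import Data.Product using (∃; ∃₂; _×_; _,_; proj₁; proj₂; map₂)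
open import Data.Sum as Sum using (_⊎_; inj₁; inj₂)
open import Data.Empty using (⊥-elim)
open import Relation.Nullary using (¬_)
open import Relation.Binary.PropositionalEquality using (_≡_; _≢_; refl; sym; trans; cong)
open import Data.Vec.Functional using (Vector)

Image : {A B : Set} → (A → B) → (A → Set) → B → Set
Image f X y = ∃ λ x → X x × f x ≡ y

All-Image⇒map : {A B : Set} {f : A → B} {X : A → Set} {ys : List B} →
                All (Image f X) ys → ∃ λ xs → All X xs × map f xs ≡ ys
All-Image⇒map [] = [] , [] , refl
All-Image⇒map ((x , Xx , refl) ∷ ps) with All-Image⇒map ps
... | xs , Xxs , refl = x ∷ xs , Xx ∷ Xxs , refl

module _ {L : Language} {n m : ℕ} (M : Structure L) (φ : Formula L (n + m))
         (a : Node → Vector (Carrier M) m) (f : Node → Node) (X : NodeSet) where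

  PartialConsistent-reindex⁺ : PartialConsistent M φ (a ∘ f) X →
                               PartialConsistent M φ a (Image f X)
  PartialConsistent-reindex⁺ pc F XF with All-Image⇒map XF
  ... | G , XG , refl = map₂ map⁺ (pc G XG)

  PartialConsistent-reindex⁻ : PartialConsistent M φ a (Image f X) →
                               PartialConsistent M φ (a ∘ f) X
  PartialConsistent-reindex⁻ pc G XG =
    map₂ map⁻ (pc (map f G) (map⁺ (All.map (λ {x} Xx → x , Xx , refl) XG)))

SSOP1-pair : Node → Node → Set
SSOP1-pair μ μ' = ∃₂ λ η ν → μ ≡ η ++ [ true ] × μ' ≡ η ++ false ∷ ν

∷-SSOP1-pair : ∀ {b μ μ'} → SSOP1-pair μ μ' → SSOP1-pair (b ∷ μ) (b ∷ μ')
∷-SSOP1-pair {b} (η , ν , refl , refl) = b ∷ η , ν , refl , refl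

∷-⊴⁻¹ : ∀ {b μ μ'} → (b ∷ μ) ⊴ (b ∷ μ') → μ ⊴ μ'
∷-⊴⁻¹ (ρ , eq) = ρ , ∷-injectiveʳ eq

-- Bits are coded as 0 ↦ 00 and 1 ↦ 01, followed by the end marker 1; but a
-- final 1 is coded as 00 without end marker, so that the code of η⁀⟨1⟩ is an
-- initial segment of the code of every η⁀⟨0⟩⁀ν.
encode : Node → Node
encode []             = [ true ]
encode (false ∷ μ)    = false ∷ false ∷ encode μ
encode (true ∷ [])    = false ∷ false ∷ []
encode (true ∷ b ∷ μ) = false ∷ true ∷ encode (b ∷ μ)

encode≢[] : ∀ μ → encode μ ≢ []
encode≢[] []            ()
encode≢[] (false ∷ μ)    ()
encode≢[] (true ∷ [])    ()
encode≢[] (true ∷ b ∷ μ) ()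

¬encode⊴[] : ∀ μ → ¬ encode μ ⊴ []
¬encode⊴[] μ (ρ , eq) = encode≢[] μ (++-conicalˡ (encode μ) ρ eq)

encode-++ : ∀ η ν → encode (η ++ [ true ]) ++ encode ν ≡ encode (η ++ false ∷ ν)
encode-++ []             ν = refl
encode-++ (false ∷ η)    ν = cong (λ w → false ∷ false ∷ w) (encode-++ η ν)
encode-++ (true ∷ [])    ν = cong (λ w → false ∷ true ∷ w) (encode-++ [] ν)
encode-++ (true ∷ b ∷ η) ν = cong (λ w → false ∷ true ∷ w) (encode-++ (b ∷ η) ν)

encode-⊴ : ∀ η ν → encode (η ++ [ true ]) ⊴ encode (η ++ false ∷ ν)
encode-⊴ η ν = encode ν , encode-++ η ν

encode-≢ : ∀ η ν → encode (η ++ [ true ]) ≢ encode (η ++ false ∷ ν)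
encode-≢ η ν eq =
  encode≢[] ν (++-identityʳ-unique (encode (η ++ [ true ])) (trans eq (sym (encode-++ η ν))))

encode-⊴⁻¹ : ∀ μ μ' → encode μ ⊴ encode μ' → μ ≡ μ' ⊎ SSOP1-pair μ μ'
encode-⊴⁻¹ []             []              _       = inj₁ refl
encode-⊴⁻¹ []             (false ∷ _)     (_ , ())
encode-⊴⁻¹ []             (true ∷ [])     (_ , ())
encode-⊴⁻¹ []             (true ∷ _ ∷ _)  (_ , ())
encode-⊴⁻¹ (false ∷ _)    []              (_ , ())
encode-⊴⁻¹ (false ∷ μ)    (false ∷ μ')    p       =
  Sum.map (cong (false ∷_)) ∷-SSOP1-pair (encode-⊴⁻¹ μ μ' (∷-⊴⁻¹ (∷-⊴⁻¹ p)))
encode-⊴⁻¹ (false ∷ μ)    (true ∷ [])     p       = ⊥-elim (¬encode⊴[] μ (∷-⊴⁻¹ (∷-⊴⁻¹ p)))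
encode-⊴⁻¹ (false ∷ _)    (true ∷ _ ∷ _)  (_ , ())
encode-⊴⁻¹ (true ∷ [])    []              (_ , ())
encode-⊴⁻¹ (true ∷ [])    (false ∷ ν)     _       = inj₂ ([] , ν , refl , refl)
encode-⊴⁻¹ (true ∷ [])    (true ∷ [])     _       = inj₁ refl
encode-⊴⁻¹ (true ∷ [])    (true ∷ _ ∷ _)  (_ , ())
encode-⊴⁻¹ (true ∷ _ ∷ _) []              (_ , ())
encode-⊴⁻¹ (true ∷ _ ∷ _) (false ∷ _)     (_ , ())
encode-⊴⁻¹ (true ∷ _ ∷ _) (true ∷ [])     (_ , ())
encode-⊴⁻¹ (true ∷ b ∷ μ) (true ∷ b' ∷ μ') p      =
  Sum.map (cong (true ∷_)) ∷-SSOP1-pair (encode-⊴⁻¹ (b ∷ μ) (b' ∷ μ') (∷-⊴⁻¹ (∷-⊴⁻¹ p)))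

SSOP1-ok⇒Antichain : ∀ X → SSOP1-ok X → Antichain (Image encode X)
SSOP1-ok⇒Antichain X ok _ _ (μ , Xμ , refl) (μ' , Xμ' , refl) μ≢μ' =
  not-below Xμ Xμ' μ≢μ' , not-below Xμ' Xμ (μ≢μ' ∘ sym)
  where
  not-below : ∀ {μ μ'} → X μ → X μ' → encode μ ≢ encode μ' → ¬ encode μ ⊴ encode μ'
  not-below {μ} {μ'} Xμ Xμ' μ≢μ' p with encode-⊴⁻¹ μ μ' p
  ... | inj₁ refl                  = μ≢μ' refl
  ... | inj₂ (η , ν , refl , refl) = ok (η , ν , Xμ , Xμ')

Antichain⇒SSOP1-ok : ∀ X → Antichain (Image encode X) → SSOP1-ok X
Antichain⇒SSOP1-ok X anti (η , ν , X₁ , X₀) =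
  proj₁ (anti _ _ (_ , X₁ , refl) (_ , X₀ , refl) (encode-≢ η ν)) (encode-⊴ η ν)

-- The SSOP₁ witness lives in the same model as the antichain tree.
proposition5p4 : ((ℓ : Level) → ExcludedMiddle ℓ) →
    (L : Language) (T : Theory L) → Complete T →
    HasAntichainTree T → HasSSOP1Witness T
proposition5p4 _ L T _ (M , M⊨T , n , m , φ , a , tree) =
  M , M⊨T , n , m , φ , a ∘ encode , λ X →
    (λ pc → Antichain⇒SSOP1-ok X
              (proj₁ (tree (Image encode X)) (PartialConsistent-reindex⁺ M φ a encode X pc))) ,
    (λ ok → PartialConsistent-reindex⁻ M φ a encode X
              (proj₂ (tree (Image encode X)) (SSOP1-ok⇒Antichain X ok)))
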